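{- Let $(S,\rho)$ be a matroid scheme and $x,y\in S$. Then $y\le\mathrm{cl}(x)$ if and only if there exists $u\in x\vee y$ with $\rho(u)=\rho(x)$.
   Context: A finite poset $S$ is a simplicial poset if it has a unique minimum, is ranked, and each $S_{\le x}$ is isomorphic to the Boolean lattice of subsets of the atoms below $x$; $|x|$ is the rank. $x\vee y$ / $x\wedge y$ are the sets of minimal common upper / maximal common lower bounds. A matroid scheme is $(S,\rho)$, $\rho:S\to\mathbb{Z}_{\ge0}$, with (M1) $0\le\rho(x)\le|x|$; (M2) monotone; (M3) $u\in x\vee y\Rightarrow\rho(x)+\rho(y)\ge\rho(u)+\rho(x\wedge y)$; (M4) $\ell\in x\wedge y,\ \rho(x)=\rho(\ell)\Rightarrow x\vee y\neq\emptyset$; (M5) $\rho(x)<\rho(y)\Rightarrow$ there is an atom $a\le y$, $a\not\le x$, $x\vee a\ne\emptyset$. The closure $\mathrm{cl}(x)$ is the unique maximal element of $\{y\in S:y\ge x,\ \rho(y)=\rho(x)\}$. -}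

module Defs where

open import Data.Nat using (ℕ; zero; suc; _+_) renaming (_≤_ to _≤ℕ_; _<_ to _<ℕ_)
open import Data.Fin using (Fin)
open import Data.Fin.Subset using (Subset; _∈_; _⊆_)
open import Data.Product using (Σ; _×_; _,_; ∃; ∃-syntax)
open import Data.Empty using (⊥)
open import Relation.Nullary using (¬_)
open import Relation.Binary.PropositionalEquality using (_≡_; _≢_)
open import Relation.Binary.Structures using (IsPartialOrder)
open import Relation.Binary.Definitions using (Decidable)
open import Function.Bundles using (_⇔_)

-- A finite poset, with carrier Fin n (every finite set is in bijection
-- with some Fin n) and a decidable partial order.
record FinPoset : Set₁ where
  field
    n      : ℕ
    _≤_    : Fin n → Fin n → Set
    ≤-dec  : Decidable _≤_
    isPO   : IsPartialOrder _≡_ _≤_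

module PosetNotions (P : FinPoset) where
  open FinPoset P public

  Elt : Set
  Elt = Fin n

  _<_ : Elt → Elt → Set
  x < y = x ≤ y × x ≢ y

  _⋖_ : Elt → Elt → Set
  x ⋖ y = x < y × (∀ z → x < z → z < y → ⊥)

  IsMinimum : Elt → Set
  IsMinimum m = ∀ x → m ≤ x

  IsAtom : Elt → Elt → Set
  IsAtom m a = m ⋖ a

  IsRankFunction : Elt → (Elt → ℕ) → Set
  IsRankFunction m rk = rk m ≡ 0 × (∀ x y → x ⋖ y → rk y ≡ suc (rk x))

  -- S_{≤x} is isomorphic (as a poset) to the Boolean lattice of all subsets
  -- of the set of atoms below x.
  AtomSubsetBelow : Elt → Elt → Subset n → Set
  AtomSubsetBelow m x A = ∀ a → a ∈ A → IsAtom m a × a ≤ x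

  BooleanBelow : Elt → Elt → Set
  BooleanBelow m x =
    Σ (Elt → Subset n) λ f → Σ (Subset n → Elt) λ g →
        (∀ z → z ≤ x → AtomSubsetBelow m x (f z))
      × (∀ A → AtomSubsetBelow m x A → g A ≤ x)
      × (∀ z → z ≤ x → g (f z) ≡ z)
      × (∀ A → AtomSubsetBelow m x A → f (g A) ≡ A)
      × (∀ z w → z ≤ x → w ≤ x → (z ≤ w ⇔ f z ⊆ f w))

  -- set of minimal common upper bounds  x ∨ y  (membership predicate)
  InJoin : Elt → Elt → Elt → Set
  InJoin x y u = x ≤ u × y ≤ u × (∀ v → x ≤ v → y ≤ v → v ≤ u → v ≡ u)

  -- set of maximal common lower bounds  x ∧ y  (membership predicate)
  InMeet : Elt → Elt → Elt → Set
  InMeet x y l = l ≤ x × l ≤ y × (∀ v → v ≤ x → v ≤ y → l ≤ v → v ≡ l)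

record SimplicialPoset : Set₁ where
  field
    poset : FinPoset
  open PosetNotions poset
  field
    bot        : Elt
    bot-min    : IsMinimum bot
    rank       : Elt → ℕ
    rank-ok    : IsRankFunction bot rank
    boolean    : ∀ x → BooleanBelow bot x

module SimplicialNotions (S : SimplicialPoset) where
  open SimplicialPoset S public
  open PosetNotions poset public

  JoinNonempty : Elt → Elt → Set
  JoinNonempty x y = ∃[ u ] InJoin x y u

  IsMatroidScheme : (Elt → ℕ) → Set
  IsMatroidScheme ρ =
      (∀ x → ρ x ≤ℕ rank x)
    × (∀ x y → x ≤ y → ρ x ≤ℕ ρ y)
    × (∀ x y u l → InJoin x y u → InMeet x y l → ρ u + ρ l ≤ℕ ρ x + ρ y)
    × (∀ x y l → InMeet x y l → ρ x ≡ ρ l → JoinNonempty x y)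
    × (∀ x y → ρ x <ℕ ρ y →
         ∃[ a ] IsAtom bot a × a ≤ y × ¬ (a ≤ x) × JoinNonempty x a)

  InClSet : (Elt → ℕ) → Elt → Elt → Set
  InClSet ρ x z = x ≤ z × ρ z ≡ ρ x

  MaximalInClSet : (Elt → ℕ) → Elt → Elt → Set
  MaximalInClSet ρ x c = InClSet ρ x c × (∀ z → InClSet ρ x z → c ≤ z → z ≡ c)

  IsClosure : (Elt → ℕ) → Elt → Elt → Set
  IsClosure ρ x c = MaximalInClSet ρ x c × (∀ c′ → MaximalInClSet ρ x c′ → c′ ≡ c)

-- If y ≤ cl x, the interval below cl x is Boolean, so it contains a least
-- upper bound u of x and y, which is then a minimal common upper bound in S;
-- ρ u = ρ x because x ≤ u ≤ cl x and ρ (cl x) = ρ x.  Conversely, a minimal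
-- common upper bound u with ρ u = ρ x belongs to the set whose unique maximal
-- element is cl x; climbing from u to a maximal element of this finite set
-- reaches cl x, so y ≤ u ≤ cl x.
module Submission where

open import Defs
open import Data.Nat using (ℕ)
open import Data.Product using (_×_; ∃-syntax)
open import Relation.Binary.PropositionalEquality using (_≡_)
open import Function.Bundles using (_⇔_)

open import Data.Nat.Properties using (≤-antisym; ≤-trans; ≤-reflexive) renaming (_≟_ to _≟ℕ_)
open import Data.Fin using (_≟_)
open import Data.Fin.Induction using (po-noetherian)
open import Data.Fin.Properties using (any?)
open import Data.Fin.Subset using (Subset; _∪_) renaming (_⊆_ to _⊆ₛ_)
open import Data.Fin.Subset.Properties using (x∈p∪q⁻; p⊆p∪q; q⊆p∪q)
open import Data.Product using (_,_; proj₁)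
open import Data.Sum using ([_,_]′)
open import Data.Empty using (⊥-elim)
open import Function.Base using (flip)
open import Function.Bundles using (Equivalence; mk⇔)
open import Induction.WellFounded using (Acc; acc)
open import Relation.Nullary using (Dec; yes; no)
open import Relation.Nullary.Decidable using (_×-dec_)
open import Relation.Binary.PropositionalEquality using (sym; subst)
open import Relation.Binary.Structures using (IsPartialOrder)
import Relation.Binary.Construct.NonStrictToStrict as ToStrict

∪-least : ∀ {n} {p q r : Subset n} → p ⊆ₛ r → q ⊆ₛ r → p ∪ q ⊆ₛ r
∪-least {p = p} {q} p⊆r q⊆r x∈p∪q = [ p⊆r , q⊆r ]′ (x∈p∪q⁻ p q x∈p∪q)

module _ (P : FinPoset) where
  open PosetNotions P
  open IsPartialOrder isPO using (trans) renaming (refl to ≤-refl)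

  Maximal : (Elt → Set) → Elt → Set
  Maximal Q z = Q z × (∀ w → Q w → z ≤ w → w ≡ z)

  maximal-above : {Q : Elt → Set} → (∀ z → Dec (Q z)) →
                  ∀ {u} → Q u → ∃[ z ] u ≤ z × Maximal Q z
  maximal-above {Q} Q? {u} = climb (po-noetherian isPO u)
    where
    _<?_ : ∀ z w → Dec (z < w)
    _<?_ = ToStrict.<-decidable _≡_ _≤_ _≟_ ≤-dec

    climb : ∀ {u} → Acc (flip _<_) u → Q u → ∃[ z ] u ≤ z × Maximal Q z
    climb {u} (acc above) Qu with any? (λ w → Q? w ×-dec u <? w)
    ... | yes (w , Qw , u<w) =
      let z , w≤z , z-max = climb (above u<w) Qw in z , trans (proj₁ u<w) w≤z , z-max
    ... | no ∄larger = u , ≤-refl , Qu , u-max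
      where
      u-max : ∀ w → Q w → u ≤ w → w ≡ u
      u-max w Qw u≤w with u ≟ w
      ... | yes u≡w = sym u≡w
      ... | no u≢w  = ⊥-elim (∄larger (w , Qw , u≤w , u≢w))

module _ (S : SimplicialPoset) where
  open SimplicialNotions S
  open IsPartialOrder isPO using (antisym; trans)

  join-below : ∀ {x y c} → x ≤ c → y ≤ c → ∃[ u ] InJoin x y u × u ≤ c
  join-below {x} {y} {c} x≤c y≤c with boolean c
  ... | f , g , f-atoms , g-below , _ , f∘g , f-order =
    u , (x≤u , y≤u , u-minimal) , u≤c
    where
    preserve : ∀ {z w} → z ≤ c → w ≤ c → z ≤ w → f z ⊆ₛ f w
    preserve z≤c w≤c = Equivalence.to (f-order _ _ z≤c w≤c)

    reflect : ∀ {z w} → z ≤ c → w ≤ c → f z ⊆ₛ f w → z ≤ w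
    reflect z≤c w≤c = Equivalence.from (f-order _ _ z≤c w≤c)

    A-atoms : AtomSubsetBelow bot c (f x ∪ f y)
    A-atoms a a∈A = [ f-atoms x x≤c a , f-atoms y y≤c a ]′ (x∈p∪q⁻ (f x) (f y) a∈A)

    u : Elt
    u = g (f x ∪ f y)

    u≤c : u ≤ c
    u≤c = g-below _ A-atoms

    fu≡A : f u ≡ f x ∪ f y
    fu≡A = f∘g _ A-atoms

    x≤u : x ≤ u
    x≤u = reflect x≤c u≤c (subst (f x ⊆ₛ_) (sym fu≡A) (p⊆p∪q (f y)))

    y≤u : y ≤ u
    y≤u = reflect y≤c u≤c (subst (f y ⊆ₛ_) (sym fu≡A) (q⊆p∪q (f x) (f y)))

    u-minimal : ∀ v → x ≤ v → y ≤ v → v ≤ u → v ≡ u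
    u-minimal v x≤v y≤v v≤u = antisym v≤u (reflect u≤c v≤c fu⊆fv)
      where
      v≤c : v ≤ c
      v≤c = trans v≤u u≤c

      fu⊆fv : f u ⊆ₛ f v
      fu⊆fv = subst (_⊆ₛ f v) (sym fu≡A)
                (∪-least (preserve x≤c v≤c x≤v) (preserve y≤c v≤c y≤v))

lemma5p3 : (S : SimplicialPoset) → let open SimplicialNotions S in
    (ρ : Elt → ℕ) → IsMatroidScheme ρ →
    (x y c : Elt) → IsClosure ρ x c →
    (y ≤ c ⇔ (∃[ u ] InJoin x y u × ρ u ≡ ρ x))
lemma5p3 S ρ (_ , ρ-mono , _) x y c (((x≤c , ρc≡ρx) , _) , c-unique) = mk⇔ to from
  where
  open SimplicialNotions S
  open IsPartialOrder isPO using (trans)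

  to : y ≤ c → ∃[ u ] InJoin x y u × ρ u ≡ ρ x
  to y≤c with join-below S x≤c y≤c
  ... | u , u∈x∨y@(x≤u , _) , u≤c =
    u , u∈x∨y , ≤-antisym (≤-trans (ρ-mono u c u≤c) (≤-reflexive ρc≡ρx)) (ρ-mono x u x≤u)

  InClSet? : ∀ z → Dec (InClSet ρ x z)
  InClSet? z = ≤-dec x z ×-dec ρ z ≟ℕ ρ x

  from : ∃[ u ] InJoin x y u × ρ u ≡ ρ x → y ≤ c
  from (u , (x≤u , y≤u , _) , ρu≡ρx) with maximal-above poset InClSet? (x≤u , ρu≡ρx)
  ... | c′ , u≤c′ , c′-max = subst (y ≤_) (c-unique c′ c′-max) (trans y≤u u≤c′)
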